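{- Let $G$ be a clockwise blue-red hackenbush position with trunk edges $t_1,\ldots,t_n$ labelled from bottom to top, and let $G_i$ denote the position resulting from deleting $t_i$. If $t_i$ and $t_j$ are blue edges and $j>i$, then $G_j>G_i$. If $t_i$ and $t_j$ are red edges and $i<j$, then $G_j<G_i$.
   Context: A clockwise blue-red hackenbush position is a finite tree rooted at a ground vertex and embedded in the plane (child edges at each vertex ordered left to right), each edge coloured blue or red. The trunk is the path from the ground obtained by repeatedly following the rightmost edge to a child until a leaf. Left may remove a blue trunk edge, Right a red trunk edge; afterwards everything disconnected from the ground is removed and the trunk is recomputed from the remaining embedded tree. Normal play convention; inequalities are between game values. -}

module Defs where

open import Data.Nat using (ℕ; zero; suc; _+_)
open import Data.Fin using (Fin)
open import Data.List using (List; []; _∷_; length; lookup)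
open import Data.Product using (_×_; _,_)
open import Data.Bool using (Bool; true; false)
open import Data.Empty using (⊥)
open import Relation.Nullary using (¬_)

data Game : Set where
  mk : (nL : ℕ) → (Fin nL → Game) → (nR : ℕ) → (Fin nR → Game) → Game

_≤G_ : Game → Game → Set
mk nL gL nR gR ≤G mk mL hL mR hR =
  ((i : Fin nL) → ¬ (mk mL hL mR hR ≤G gL i)) ×
  ((j : Fin mR) → ¬ (hR j ≤G mk nL gL nR gR))

_<G_ : Game → Game → Set
G <G H = (G ≤G H) × ¬ (H ≤G G)

_>G_ : Game → Game → Set
G >G H = H <G G

-- A tree rooted at the ground: the list of edges leaving a vertex,
-- ordered left to right, each edge carrying a colour and the subtree
-- hanging above it.

data Colour : Set where
  blue red : Colour

data Tree : Set where
  node : List (Colour × Tree) → Tree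

mutual
  -- trunk colours, bottom to top: follow the rightmost (= last) edge.
  trunk : Tree → List Colour
  trunk (node es) = trunkL es

  trunkL : List (Colour × Tree) → List Colour
  trunkL [] = []
  trunkL ((c , t) ∷ []) = c ∷ trunk t
  trunkL (_ ∷ e ∷ es) = trunkL (e ∷ es)

mutual
  -- del k t : delete the trunk edge with 0-based index k (from the bottom);
  -- everything above it (disconnected from the ground) disappears.
  del : ℕ → Tree → Tree
  del k (node es) = node (delL k es)

  delL : ℕ → List (Colour × Tree) → List (Colour × Tree)
  delL k [] = []
  delL zero (_ ∷ []) = []
  delL (suc k) ((c , t) ∷ []) = (c , del k t) ∷ []
  delL k (e ∷ e' ∷ es) = e ∷ delL k (e' ∷ es)

mutual
  size : Tree → ℕ
  size (node es) = sizeL es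

  sizeL : List (Colour × Tree) → ℕ
  sizeL [] = 0
  sizeL ((_ , t) ∷ es) = suc (size t + sizeL es)

sameColour : Colour → Colour → Bool
sameColour blue blue = true
sameColour red red = true
sameColour _ _ = false

positionsFrom : ℕ → Colour → List Colour → List ℕ
positionsFrom n c [] = []
positionsFrom n c (d ∷ ds) with sameColour c d
... | true  = n ∷ positionsFrom (suc n) c ds
... | false = positionsFrom (suc n) c ds

positions : Colour → List Colour → List ℕ
positions = positionsFrom 0

-- The fuel argument is the
-- number of edges; every move removes at least one edge, so with
-- fuel = size t the fuel never runs out before the position is empty
-- (the fuel-0 case is only reached for the empty tree, whose value is 0).
gameF : ℕ → Tree → Game
gameF zero t = mk 0 (λ ()) 0 (λ ())
gameF (suc f) t =
  mk (length bs) (λ i → gameF f (del (lookup bs i) t))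
     (length rs) (λ j → gameF f (del (lookup rs j) t))
  where
    bs = positions blue (trunk t)
    rs = positions red (trunk t)

game : Tree → Game
game t = gameF (size t) t

-- Write G_k for G with trunk edge k deleted, so that G_k is a Left option
-- of G when edge k is blue and a Right option when it is red.  By induction
-- on the number of edges, G_k ≤ G for every blue k (dually G ≤ G_k for red k):
-- a Left option G_km of G_k satisfies G_km ≤ G_k by induction, so G ≤ G_km
-- would give G ≤ G_k; and for red r we get G_k ⧏ G_r because deleting the
-- higher of two trunk edges and then the lower one is the same as deleting
-- only the lower one, so one of G_k, G_r is an option of the other.  The same
-- observation makes G_i an option of G_j for i < j, hence G_i < G_j when
-- edge i is blue.
module Submission where

open import Defs
open import Data.Fin using (Fin; toℕ; _<_)
open import Data.List using (length; lookup)
open import Data.Product using (_×_)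
open import Relation.Binary.PropositionalEquality using (_≡_)

open import Data.Fin using (zero; suc)
open import Data.List using (List; []; _∷_)
open import Data.List.Membership.Propositional using (_∈_)
open import Data.List.Membership.Propositional.Properties using (∈-lookup)
open import Data.List.Relation.Unary.Any using (here; there; index)
open import Data.List.Relation.Unary.Any.Properties using (lookup-index)
open import Data.Bool using (true; false)
open import Data.Maybe using (Maybe; just; nothing)
open import Data.Nat as ℕ using (ℕ; zero; suc; _+_; z≤n; s≤s)
open import Data.Nat.Induction using (<-wellFounded)
open import Data.Nat.Properties
open import Data.Product using (∃-syntax; _,_)
open import Induction.WellFounded using (Acc; acc)
open import Relation.Binary.Definitions using (tri<; tri≈; tri>)
open import Relation.Binary.PropositionalEquality using (refl; sym; trans; cong; subst)
open import Relation.Nullary using (¬_)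

infix 4 _⧏G_

_⧏G_ : Game → Game → Set
G ⧏G H = ¬ (H ≤G G)

≤G-left : ∀ {nL gL nR gR} H → mk nL gL nR gR ≤G H → ∀ i → gL i ⧏G H
≤G-left (mk _ _ _ _) (left , _) = left

≤G-right : ∀ G {mL hL mR hR} → G ≤G mk mL hL mR hR → ∀ j → G ⧏G hR j
≤G-right (mk _ _ _ _) (_ , right) = right

≤G-refl : ∀ G → G ≤G G
≤G-refl (mk nL gL nR gR) =
  (λ i p → ≤G-left (gL i) p i (≤G-refl (gL i))) ,
  (λ j p → ≤G-right (gR j) p j (≤G-refl (gR j)))

≤G-trans : ∀ {G H K} → G ≤G H → H ≤G K → G ≤G K
≤G-trans {mk nL gL nR gR} {H} {mk mL hL mR hR} p q =
  (λ i r → ≤G-left H p i (≤G-trans q r)) ,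
  (λ j r → ≤G-right H q j (≤G-trans r p))

leftOption-⧏ : ∀ {nL gL nR gR} i → gL i ⧏G mk nL gL nR gR
leftOption-⧏ {gL = gL} i p = ≤G-left (gL i) p i (≤G-refl (gL i))

rightOption-⧏ : ∀ {nL gL nR gR} j → mk nL gL nR gR ⧏G gR j
rightOption-⧏ {gR = gR} j p = ≤G-right (gR j) p j (≤G-refl (gR j))

mk-mono : ∀ {nL gL hL nR gR hR} →
  (∀ i → gL i ≤G hL i) → (∀ j → gR j ≤G hR j) →
  mk nL gL nR gR ≤G mk nL hL nR hR
mk-mono gL≤hL gR≤hR =
  (λ i p → leftOption-⧏ i (≤G-trans p (gL≤hL i))) ,
  (λ j p → rightOption-⧏ j (≤G-trans (gR≤hR j) p))

nth : ∀ {A : Set} → List A → ℕ → Maybe A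
nth []       _       = nothing
nth (x ∷ xs) zero    = just x
nth (x ∷ xs) (suc k) = nth xs k

nth-lookup : ∀ {A : Set} (xs : List A) i → nth xs (toℕ i) ≡ just (lookup xs i)
nth-lookup (x ∷ xs) zero    = refl
nth-lookup (x ∷ xs) (suc i) = nth-lookup xs i

sameColour⇒≡ : ∀ {c d} → sameColour c d ≡ true → c ≡ d
sameColour⇒≡ {blue} {blue} refl = refl
sameColour⇒≡ {red}  {red}  refl = refl

∈-positionsFrom⁺ : ∀ n cs {c k} → nth cs k ≡ just c → n + k ∈ positionsFrom n c cs
∈-positionsFrom⁺ n (blue ∷ ds) {blue} {zero} refl = here (+-identityʳ n)
∈-positionsFrom⁺ n (red ∷ ds)  {red}  {zero} refl = here (+-identityʳ n)
∈-positionsFrom⁺ n (d ∷ ds) {c} {suc k} h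
  with sameColour c d
     | subst (_∈ positionsFrom (suc n) c ds) (sym (+-suc n k)) (∈-positionsFrom⁺ (suc n) ds h)
... | true  | k∈ = there k∈
... | false | k∈ = k∈

∈-positionsFrom⁻ : ∀ n cs {c m} → m ∈ positionsFrom n c cs →
  ∃[ k ] m ≡ n + k × nth cs k ≡ just c
∈-positionsFrom⁻ n (d ∷ ds) {c} p with sameColour c d in same | p
... | true  | here refl = 0 , sym (+-identityʳ n) , cong just (sym (sameColour⇒≡ same))
... | true  | there q   with ∈-positionsFrom⁻ (suc n) ds q
...   | k , refl , h    = suc k , sym (+-suc n k) , h
∈-positionsFrom⁻ n (d ∷ ds) p | false | q with ∈-positionsFrom⁻ (suc n) ds q
...   | k , refl , h    = suc k , sym (+-suc n k) , h

∈-positions⁺ : ∀ cs {c k} → nth cs k ≡ just c → k ∈ positions c cs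
∈-positions⁺ = ∈-positionsFrom⁺ 0

∈-positions⁻ : ∀ cs {c k} → k ∈ positions c cs → nth cs k ≡ just c
∈-positions⁻ cs p with ∈-positionsFrom⁻ 0 cs p
... | _ , refl , h = h

TrunkEdge : Colour → Tree → ℕ → Set
TrunkEdge c t k = nth (trunk t) k ≡ just c

mutual
  size-del-< : ∀ t {k c} → TrunkEdge c t k → size (del k t) ℕ.< size t
  size-del-< (node es) = sizeL-delL-< es

  sizeL-delL-< : ∀ es {k c} → nth (trunkL es) k ≡ just c → sizeL (delL k es) ℕ.< sizeL es
  sizeL-delL-< ((d , t) ∷ [])     {zero}  h = s≤s z≤n
  sizeL-delL-< ((d , t) ∷ [])     {suc k} h = s≤s (+-monoˡ-< 0 (size-del-< t h))
  sizeL-delL-< ((d , t) ∷ e ∷ es) {zero}  h = s≤s (+-monoʳ-< (size t) (sizeL-delL-< (e ∷ es) h))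
  sizeL-delL-< ((d , t) ∷ e ∷ es) {suc k} h = s≤s (+-monoʳ-< (size t) (sizeL-delL-< (e ∷ es) h))

mutual
  trunk-del-below : ∀ t {m k} → m ℕ.< k → nth (trunk (del k t)) m ≡ nth (trunk t) m
  trunk-del-below (node es) = trunkL-delL-below es

  trunkL-delL-below : ∀ es {m k} → m ℕ.< k → nth (trunkL (delL k es)) m ≡ nth (trunkL es) m
  trunkL-delL-below []                                        m<k       = refl
  trunkL-delL-below ((d , t) ∷ [])          {zero}  {suc k}   m<k       = refl
  trunkL-delL-below ((d , t) ∷ [])          {suc m} {suc k}   (s≤s m<k) = trunk-del-below t m<k
  trunkL-delL-below (e ∷ e′ ∷ [])          {k = suc k}       m<k       = trunkL-delL-below (e′ ∷ []) m<k
  trunkL-delL-below (e ∷ e′ ∷ e″ ∷ es)     {k = suc k}       m<k       = trunkL-delL-below (e′ ∷ e″ ∷ es) m<k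

TrunkEdge-del : ∀ t {c m k} → m ℕ.< k → TrunkEdge c t m → TrunkEdge c (del k t) m
TrunkEdge-del t m<k h = trans (trunk-del-below t m<k) h

mutual
  del-del : ∀ t {m k} → m ℕ.< k → del m (del k t) ≡ del m t
  del-del (node es) m<k = cong node (delL-delL es m<k)

  delL-delL : ∀ es {m k} → m ℕ.< k → delL m (delL k es) ≡ delL m es
  delL-delL []                                       m<k       = refl
  delL-delL ((d , t) ∷ [])         {zero}  {suc k}   m<k       = refl
  delL-delL ((d , t) ∷ [])         {suc m} {suc k}   (s≤s m<k) = cong (λ u → (d , u) ∷ []) (del-del t m<k)
  delL-delL (e ∷ e′ ∷ [])          {zero}  {suc k}   m<k       = cong (e ∷_) (delL-delL (e′ ∷ []) m<k)
  delL-delL (e ∷ e′ ∷ [])          {suc m} {suc k}   m<k       = cong (e ∷_) (delL-delL (e′ ∷ []) m<k)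
  delL-delL (e ∷ e′ ∷ e″ ∷ es)     {zero}  {suc k}   m<k       = cong (e ∷_) (delL-delL (e′ ∷ e″ ∷ es) m<k)
  delL-delL (e ∷ e′ ∷ e″ ∷ es)     {suc m} {suc k}   m<k       = cong (e ∷_) (delL-delL (e′ ∷ e″ ∷ es) m<k)

option-size-< : ∀ t c (i : Fin (length (positions c (trunk t)))) →
  size (del (lookup (positions c (trunk t)) i) t) ℕ.< size t
option-size-< t c i = size-del-< t (∈-positions⁻ (trunk t) (∈-lookup i))

gameF-fuel : ∀ f f′ t → size t ℕ.≤ f → size t ℕ.≤ f′ → gameF f t ≤G gameF f′ t
gameF-fuel (suc f) (suc f′) t sf sf′ =
  mk-mono (λ i → gameF-fuel f f′ _ (bound blue i sf) (bound blue i sf′))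
          (λ j → gameF-fuel f f′ _ (bound red j sf) (bound red j sf′))
  where
  bound : ∀ c i {g} → size t ℕ.≤ suc g → size (del (lookup (positions c (trunk t)) i) t) ℕ.≤ g
  bound c i st = ≤-pred (≤-trans (option-size-< t c i) st)
gameF-fuel zero    zero     _                _  _  = (λ ()) , (λ ())
gameF-fuel zero    (suc f′) (node [])        _  _  = (λ ()) , (λ ())
gameF-fuel (suc f) zero     (node [])        _  _  = (λ ()) , (λ ())
gameF-fuel zero    (suc f′) (node (_ ∷ _))   () _
gameF-fuel (suc f) zero     (node (_ ∷ _))   _  ()

-- Equal in value to game t, but its options are literally the values
-- game (del k t) rather than gameF at some leftover fuel.
unfoldGame : Tree → Game
unfoldGame t =
  mk (length bs) (λ i → game (del (lookup bs i) t))
     (length rs) (λ j → game (del (lookup rs j) t))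
  where
  bs = positions blue (trunk t)
  rs = positions red (trunk t)

game≤unfoldGame : ∀ t → game t ≤G unfoldGame t
game≤unfoldGame t =
  ≤G-trans (gameF-fuel (size t) (suc (size t)) t ≤-refl (n≤1+n _))
           (mk-mono (λ i → gameF-fuel _ _ _ (<⇒≤ (option-size-< t blue i)) ≤-refl)
                    (λ j → gameF-fuel _ _ _ (<⇒≤ (option-size-< t red j)) ≤-refl))

unfoldGame≤game : ∀ t → unfoldGame t ≤G game t
unfoldGame≤game t =
  ≤G-trans (mk-mono (λ i → gameF-fuel _ _ _ ≤-refl (<⇒≤ (option-size-< t blue i)))
                    (λ j → gameF-fuel _ _ _ ≤-refl (<⇒≤ (option-size-< t red j))))
           (gameF-fuel (suc (size t)) (size t) t (n≤1+n _) ≤-refl)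

del-blue-⧏ : ∀ {t k} → TrunkEdge blue t k → game (del k t) ⧏G game t
del-blue-⧏ {t} hk t≤tₖ =
  leftOption-⧏ (index k∈bs)
    (subst (λ m → unfoldGame t ≤G game (del m t)) (lookup-index k∈bs)
           (≤G-trans (unfoldGame≤game t) t≤tₖ))
  where k∈bs = ∈-positions⁺ (trunk t) hk

⧏-del-red : ∀ {t k} → TrunkEdge red t k → game t ⧏G game (del k t)
⧏-del-red {t} hk tₖ≤t =
  rightOption-⧏ (index k∈rs)
    (subst (λ m → game (del m t) ≤G unfoldGame t) (lookup-index k∈rs)
           (≤G-trans tₖ≤t (game≤unfoldGame t)))
  where k∈rs = ∈-positions⁺ (trunk t) hk

game-≤-intro : ∀ A B →
  (∀ {m} → TrunkEdge blue A m → game (del m A) ⧏G game B) →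
  (∀ {r} → TrunkEdge red B r → game A ⧏G game (del r B)) →
  game A ≤G game B
game-≤-intro A B leftA⧏B A⧏rightB =
  ≤G-trans (game≤unfoldGame A) (≤G-trans unfoldA≤unfoldB (unfoldGame≤game B))
  where
  unfoldA≤unfoldB : unfoldGame A ≤G unfoldGame B
  unfoldA≤unfoldB =
    (λ i p → leftA⧏B (∈-positions⁻ (trunk A) (∈-lookup i)) (≤G-trans (game≤unfoldGame B) p)) ,
    (λ j p → A⧏rightB (∈-positions⁻ (trunk B) (∈-lookup j)) (≤G-trans p (unfoldGame≤game A)))

del-blue⧏del-red : ∀ {t b r} → TrunkEdge blue t b → TrunkEdge red t r →
  game (del b t) ⧏G game (del r t)
del-blue⧏del-red {t} {b} {r} hb hr with <-cmp b r
... | tri< b<r _ _ =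
  subst (λ u → game u ⧏G game (del r t)) (del-del t b<r) (del-blue-⧏ (TrunkEdge-del t b<r hb))
... | tri> _ _ r<b =
  subst (λ u → game (del b t) ⧏G game u) (del-del t r<b) (⧏-del-red (TrunkEdge-del t r<b hr))
... | tri≈ _ refl _ with trans (sym hb) hr
...   | ()

del-blue-≤ : ∀ {t k} → TrunkEdge blue t k → game (del k t) ≤G game t
del-blue-≤ {t} = go t (<-wellFounded (size t))
  where
  go : ∀ t {k} → Acc ℕ._<_ (size t) → TrunkEdge blue t k → game (del k t) ≤G game t
  go t {k} (acc smaller) hk = game-≤-intro (del k t) t
    (λ hm t≤tₖₘ → del-blue-⧏ hk (≤G-trans t≤tₖₘ (go (del k t) (smaller (size-del-< t hk)) hm)))
    (del-blue⧏del-red hk)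

del-red-≥ : ∀ {t k} → TrunkEdge red t k → game t ≤G game (del k t)
del-red-≥ {t} = go t (<-wellFounded (size t))
  where
  go : ∀ t {k} → Acc ℕ._<_ (size t) → TrunkEdge red t k → game t ≤G game (del k t)
  go t {k} (acc smaller) hk = game-≤-intro t (del k t)
    (λ hm → del-blue⧏del-red hm hk)
    (λ hr tₖᵣ≤t → ⧏-del-red hk (≤G-trans (go (del k t) (smaller (size-del-< t hk)) hr) tₖᵣ≤t))

del-blue-< : ∀ {t k} → TrunkEdge blue t k → game (del k t) <G game t
del-blue-< hk = del-blue-≤ hk , del-blue-⧏ hk

del-red-> : ∀ {t k} → TrunkEdge red t k → game (del k t) >G game t
del-red-> hk = del-red-≥ hk , ⧏-del-red hk

lemma2p3 : (G : Tree) (i j : Fin (length (trunk G))) →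
    ((lookup (trunk G) i ≡ blue → lookup (trunk G) j ≡ blue → i < j →
        game (del (toℕ j) G) >G game (del (toℕ i) G))
    × (lookup (trunk G) i ≡ red → lookup (trunk G) j ≡ red → i < j →
        game (del (toℕ j) G) <G game (del (toℕ i) G)))
-- The colour of edge j is irrelevant: G_i is an option of G_j regardless.
lemma2p3 G i j =
  (λ hi _ i<j → subst (λ u → game u <G game Gⱼ) (del-del G i<j) (del-blue-< (edgeOfGⱼ i<j hi))) ,
  (λ hi _ i<j → subst (λ u → game u >G game Gⱼ) (del-del G i<j) (del-red-> (edgeOfGⱼ i<j hi)))
  where
  Gⱼ = del (toℕ j) G
  edgeOfGⱼ : ∀ {c} → i < j → lookup (trunk G) i ≡ c → TrunkEdge c Gⱼ (toℕ i)
  edgeOfGⱼ i<j hi = TrunkEdge-del G i<j (trans (nth-lookup (trunk G) i) (cong just hi))
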